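{- Let $G$ be a connected graph of order $n\geq 6$ that has exactly one Hamiltonian cycle. Then $D(G)\leq 2$.
   Context: All graphs are finite, simple and undirected. A vertex labeling $\phi:V(G)\to\{1,\dots,r\}$ is $r$-distinguishing if the only automorphism of $G$ preserving all vertex labels is the identity. The distinguishing number $D(G)$ is the least $r$ such that $G$ has an $r$-distinguishing vertex labeling. -}

module Defs where

open import Data.Nat using (ℕ; zero; suc; _≤_; _<_)
open import Data.Nat.DivMod using (_mod_)
open import Data.Fin using (Fin; toℕ)
open import Data.Bool using (Bool; true; false)
open import Data.Product using (Σ; ∃; _×_; _,_)
open import Data.Sum using (_⊎_)
open import Data.Empty using (⊥)
open import Relation.Nullary using (¬_)
open import Relation.Binary.PropositionalEquality using (_≡_)

record Graph (n : ℕ) : Set where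
  field
    adj   : Fin n → Fin n → Bool
    sym   : ∀ u v → adj u v ≡ adj v u
    irrefl : ∀ v → adj v v ≡ false

open Graph public

Adjacent : ∀ {n} → Graph n → Fin n → Fin n → Set
Adjacent G u v = adj G u v ≡ true

Connected : ∀ {n} → Graph n → Set
Connected {n} G = ∀ (u v : Fin n) → Σ ℕ λ k → Σ (Fin (suc k) → Fin n) λ p →
  (p Data.Fin.zero ≡ u) × (p (Data.Fin.fromℕ k) ≡ v) ×
  (∀ (i : Fin k) → Adjacent G (p (Data.Fin.inject₁ i)) (p (Data.Fin.suc i)))

record Automorphism {n : ℕ} (G : Graph n) : Set where
  field
    σ     : Fin n → Fin n
    σ⁻¹   : Fin n → Fin n
    left  : ∀ v → σ⁻¹ (σ v) ≡ v
    right : ∀ v → σ (σ⁻¹ v) ≡ v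
    pres  : ∀ u v → adj G (σ u) (σ v) ≡ adj G u v

open Automorphism public

Distinguishing : ∀ {n} (G : Graph n) (r : ℕ) → (Fin n → Fin r) → Set
Distinguishing {n} G r φ =
  (f : Automorphism G) → (∀ v → φ (σ f v) ≡ φ v) → ∀ v → σ f v ≡ v

-- D(G) ≤ m : the least r admitting an r-distinguishing labeling is at most m,
-- i.e. some r ≤ m admits an r-distinguishing labeling.
DistNum≤ : ∀ {n} → Graph n → ℕ → Set
DistNum≤ {n} G m = Σ ℕ λ r → r ≤ m × Σ (Fin n → Fin r) λ φ → Distinguishing G r φ

-- A Hamiltonian cycle is presented by a cyclic ordering of all vertices:
-- a bijection c : Fin n → Fin n (position ↦ vertex) with c i adjacent to c (i+1 mod n).
-- (Meaningful for n ≥ 3.)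
next : ∀ {n} → Fin n → Fin n
next {suc n} i = (suc (toℕ i)) mod (suc n)

record HamOrdering {n : ℕ} (G : Graph n) : Set where
  field
    pos   : Fin n → Fin n
    pos⁻¹ : Fin n → Fin n
    left  : ∀ v → pos⁻¹ (pos v) ≡ v
    right : ∀ v → pos (pos⁻¹ v) ≡ v
    step  : ∀ i → Adjacent G (pos i) (pos (next i))

open HamOrdering public

CycleEdge : ∀ {n} {G : Graph n} → HamOrdering G → Fin n → Fin n → Set
CycleEdge {n} h a b = Σ (Fin n) λ i →
  ((pos h i ≡ a) × (pos h (next i) ≡ b)) ⊎ ((pos h i ≡ b) × (pos h (next i) ≡ a))

-- Two orderings describe the same Hamiltonian cycle (same subgraph) iff same edge set.
SameCycle : ∀ {n} {G : Graph n} → HamOrdering G → HamOrdering G → Set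
SameCycle {n} h h' = ∀ (a b : Fin n) →
  (CycleEdge h a b → CycleEdge h' a b) × (CycleEdge h' a b → CycleEdge h a b)

UniquelyHamiltonian : ∀ {n} → Graph n → Set
UniquelyHamiltonian G = Σ (HamOrdering G) λ h → ∀ (h' : HamOrdering G) → SameCycle h h'

module Submission where

-- Fix the Hamiltonian ordering pos : positions → vertices.  An automorphism f carries
-- it to the Hamiltonian ordering f ∘ pos, which by uniqueness describes the same
-- cycle; so the induced map pos⁻¹ ∘ f ∘ pos on positions is an injective cycle map
-- (consecutive positions go to consecutive positions, in either orientation).  It
-- therefore suffices to give a rigid labeling of positions: one that only the
-- identity cycle map preserves (`rigid⇒distinguishing`).  We mark positions 0, 1, 3.
-- The only edge of the cycle with both ends marked is {0, 1}, so a label-preserving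
-- cycle map fixes 0 and 1 or swaps them.  Fixing two consecutive positions forces the
-- identity, by walking once around the cycle (`cycleMap-fixing-edge`, which needs
-- length ≥ 3); swapping them would send the marked position 3 to the unmarked
-- position n - 2 (`marked-no-swap`, which needs n ≥ 6).

open import Defs hiding (sym)
open import Data.Nat using (ℕ; zero; suc; _+_; _≤_; _<_; _%_; s≤s; z≤n)
open import Data.Nat.Properties
  using (<-cmp; <-irrefl; <-≤-trans; <⇒≤; ≤-pred; ≤-refl; ≤-reflexive; ≤-trans;
         suc-injective; 1+n≢0; m≢1+n+m)
open import Data.Nat.DivMod using (m<n⇒m%n≡m; n%n≡0)
open import Data.Fin using (Fin; toℕ; suc)
open import Data.Fin.Patterns using (0F; 1F; 2F; 3F)
open import Data.Fin.Properties using (toℕ-injective; toℕ-fromℕ<; toℕ<n)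
open import Data.Product using (_×_; _,_; proj₁; proj₂)
open import Data.Sum using (_⊎_; inj₁; inj₂)
open import Data.Empty using (⊥; ⊥-elim)
open import Function using (_∘_)
open import Function.Definitions using (Injective)
open import Function.Consequences.Propositional
  using (inverseʳ⇒injective; strictlyInverseʳ⇒inverseʳ)
open import Relation.Binary.PropositionalEquality
open import Relation.Binary.Definitions using (tri<; tri≈; tri>)

next-cases : ∀ {n} (x : Fin (suc n)) →
  (toℕ (next x) ≡ suc (toℕ x) × toℕ x < n) ⊎ (toℕ (next x) ≡ 0 × toℕ x ≡ n)
next-cases {n} x with <-cmp (toℕ x) n
... | tri< x<n _ _ = inj₁ (trans (toℕ-fromℕ< _) (m<n⇒m%n≡m (s≤s x<n)) , x<n)
... | tri≈ _ x≡n _ =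
  inj₂ (trans (toℕ-fromℕ< _) (trans (cong (λ k → suc k % suc n) x≡n) (n%n≡0 (suc n))) , x≡n)
... | tri> _ _ x>n = ⊥-elim (<-irrefl refl (<-≤-trans x>n (≤-pred (toℕ<n x))))

next-succ : ∀ {n} (x : Fin (suc n)) → toℕ x < n → toℕ (next x) ≡ suc (toℕ x)
next-succ x x<n with next-cases x
... | inj₁ (e , _)   = e
... | inj₂ (_ , x≡n) = ⊥-elim (<-irrefl x≡n x<n)

next-injective : ∀ {n} → Injective _≡_ _≡_ (next {suc n})
next-injective {x = x} {y} e with next-cases x | next-cases y
... | inj₁ (ex , _) | inj₁ (ey , _) =
  toℕ-injective (suc-injective (trans (sym ex) (trans (cong toℕ e) ey)))
... | inj₁ (ex , _) | inj₂ (ey , _) = ⊥-elim (1+n≢0 (trans (sym ex) (trans (cong toℕ e) ey)))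
... | inj₂ (ex , _) | inj₁ (ey , _) = ⊥-elim (1+n≢0 (trans (sym ey) (trans (cong toℕ (sym e)) ex)))
... | inj₂ (_ , x≡n) | inj₂ (_ , y≡n) = toℕ-injective (trans x≡n (sym y≡n))

next²-fixed⇒short : ∀ {n} (x : Fin (suc n)) → next (next x) ≡ x → n ≤ 1
next²-fixed⇒short x loop with next-cases x | next-cases (next x)
... | inj₁ (e₁ , _) | inj₁ (e₂ , _) =
  ⊥-elim (m≢1+n+m (toℕ x) (trans (cong toℕ (sym loop)) (trans e₂ (cong suc e₁))))
... | inj₁ (e₁ , _) | inj₂ (e₂ , nx≡n) =
  ≤-reflexive (trans (sym nx≡n) (trans e₁ (cong suc (trans (cong toℕ (sym loop)) e₂))))
... | inj₂ (e₁ , x≡n) | inj₁ (e₂ , _) =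
  ≤-reflexive (trans (sym x≡n) (trans (cong toℕ (sym loop)) (trans e₂ (cong suc e₁))))
... | inj₂ (e₁ , _) | inj₂ (_ , nx≡n) = ≤-trans (≤-reflexive (trans (sym nx≡n) e₁)) z≤n

walk : ∀ {n} → ℕ → Fin (suc n)
walk zero    = 0F
walk (suc k) = next (walk k)

toℕ-walk : ∀ {n} k → k ≤ n → toℕ (walk {n} k) ≡ k
toℕ-walk zero    _   = refl
toℕ-walk {n} (suc k) k<n = trans (next-succ (walk k) (subst (_< n) (sym ih) k<n)) (cong suc ih)
  where
  ih : toℕ (walk {n} k) ≡ k
  ih = toℕ-walk k (<⇒≤ k<n)

walk-toℕ : ∀ {n} (i : Fin (suc n)) → walk (toℕ i) ≡ i
walk-toℕ i = toℕ-injective (toℕ-walk (toℕ i) (≤-pred (toℕ<n i)))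

CycleMap : ∀ {n} → (Fin n → Fin n) → Set
CycleMap g = ∀ i → g (next i) ≡ next (g i) ⊎ next (g (next i)) ≡ g i

cycleMap-fixing-edge : ∀ {n} → 2 ≤ n → (g : Fin (suc n) → Fin (suc n)) →
  Injective _≡_ _≡_ g → CycleMap g →
  g 0F ≡ 0F → g (next 0F) ≡ next 0F →
  ∀ i → g i ≡ i
cycleMap-fixing-edge {n} 2≤n g g-inj g-cyc fix₀ fix₁ i =
  subst (λ j → g j ≡ j) (walk-toℕ i) (proj₁ (fixes (toℕ i)))
  where
  -- Walking forward, g keeps fixing the current edge: turning backwards would map
  -- the position two steps ahead onto the current one, which injectivity forbids.
  fixes : ∀ k → g (walk k) ≡ walk k × g (walk (suc k)) ≡ walk (suc k)
  fixes zero = fix₀ , fix₁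
  fixes (suc k) with fixes k | g-cyc (walk (suc k))
  ... | _ , fixed₁ | inj₁ forward = fixed₁ , trans forward (cong next fixed₁)
  ... | fixed₀ , fixed₁ | inj₂ backward =
    ⊥-elim (<-irrefl refl (<-≤-trans 2≤n (next²-fixed⇒short (walk k) (g-inj (next-injective
      (begin
        next (g (walk (suc (suc k))))  ≡⟨ backward ⟩
        g (walk (suc k))               ≡⟨ fixed₁ ⟩
        next (walk k)                  ≡⟨ cong next (sym fixed₀) ⟩
        next (g (walk k))              ∎))))))
    where open ≡-Reasoning

Rigid : ∀ {n r} → (Fin n → Fin r) → Set
Rigid L = ∀ g → Injective _≡_ _≡_ g → CycleMap g → (∀ i → L (g i) ≡ L i) → ∀ i → g i ≡ i

mark : ∀ {m} → Fin (6 + m) → Fin 2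
mark 0F = 1F
mark 1F = 1F
mark 3F = 1F
mark _  = 0F

Marked : ∀ {m} → Fin (6 + m) → Set
Marked x = mark x ≡ 1F

marked-edge : ∀ {m} (x : Fin (6 + m)) → Marked x → Marked (next x) → x ≡ 0F
marked-edge 0F _ _ = refl
marked-edge 1F _ ()
marked-edge 3F _ ()
marked-edge 2F () _
marked-edge (suc (suc (suc (suc _)))) () _

-- … and the penultimate position n - 2 is unmarked (this is where n ≥ 6 is needed).
marked-not-penultimate : ∀ {m} (x : Fin (6 + m)) → Marked x → next (next x) ≢ 0F
marked-not-penultimate 0F _ ()
marked-not-penultimate 1F _ ()
marked-not-penultimate 3F _ ()
marked-not-penultimate 2F () _
marked-not-penultimate (suc (suc (suc (suc _)))) () _

-- A mark-preserving cycle map cannot swap 0 and 1: as a reflection of the cycle it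
-- would have to send the marked position 3 to the unmarked position n - 2.
marked-no-swap : ∀ {m} (g : Fin (6 + m) → Fin (6 + m)) → Injective _≡_ _≡_ g → CycleMap g →
  (∀ i → mark (g i) ≡ mark i) → g 0F ≡ 1F → g 1F ≡ 0F → ⊥
marked-no-swap g g-inj g-cyc g-mark swap₀ swap₁ with g-cyc 1F
... | inj₁ forward with () ← g-inj (trans forward (trans (cong next swap₁) (sym swap₀)))
... | inj₂ backward₁ with g-cyc 2F
...   | inj₁ forward with () ← g-inj (trans forward backward₁)
...   | inj₂ backward₂ = marked-not-penultimate (g 3F) (g-mark 3F)
          (trans (cong next backward₂) (trans backward₁ swap₁))

mark-rigid : ∀ m → Rigid (mark {m})
mark-rigid m g g-inj g-cyc g-mark with g-cyc 0F
... | inj₁ forward =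
  cycleMap-fixing-edge (s≤s (s≤s z≤n)) g g-inj g-cyc fix₀ (trans forward (cong next fix₀))
  where
  fix₀ : g 0F ≡ 0F
  fix₀ = marked-edge (g 0F) (g-mark 0F) (subst Marked forward (g-mark 1F))
... | inj₂ backward =
  ⊥-elim (marked-no-swap g g-inj g-cyc g-mark (trans (sym backward) (cong next swap₁)) swap₁)
  where
  swap₁ : g 1F ≡ 0F
  swap₁ = marked-edge (g 1F) (g-mark 1F) (subst Marked (sym backward) (g-mark 0F))

retraction⇒injective : ∀ {A B : Set} (u : A → B) (u⁻¹ : B → A) →
  (∀ a → u⁻¹ (u a) ≡ a) → Injective _≡_ _≡_ u
retraction⇒injective u u⁻¹ inv = inverseʳ⇒injective u (strictlyInverseʳ⇒inverseʳ {f⁻¹ = u⁻¹} u inv)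

module _ {n : ℕ} {G : Graph n} where

  pos⁻¹-at : (h : HamOrdering G) {j : Fin n} {v : Fin n} → pos h j ≡ v → pos⁻¹ h v ≡ j
  pos⁻¹-at h {j} refl = HamOrdering.left h j

  transport : Automorphism G → HamOrdering G → HamOrdering G
  transport f h = record
    { pos   = σ f ∘ pos h
    ; pos⁻¹ = pos⁻¹ h ∘ σ⁻¹ f
    ; left  = λ v → trans (cong (pos⁻¹ h) (Automorphism.left f _)) (HamOrdering.left h v)
    ; right = λ v → trans (cong (σ f) (HamOrdering.right h _)) (Automorphism.right f v)
    ; step  = λ i → trans (pres f _ _) (step h i)
    }

  positionMap : Automorphism G → HamOrdering G → Fin n → Fin n
  positionMap f h = pos⁻¹ h ∘ σ f ∘ pos h

  positionMap-injective : ∀ f h → Injective _≡_ _≡_ (positionMap f h)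
  positionMap-injective f h e =
    retraction⇒injective (pos h) (pos⁻¹ h) (HamOrdering.left h)
      (retraction⇒injective (σ f) (σ⁻¹ f) (Automorphism.left f)
        (retraction⇒injective (pos⁻¹ h) (pos h) (HamOrdering.right h) e))

  positionMap-cycleMap : ∀ f h → SameCycle h (transport f h) → CycleMap (positionMap f h)
  positionMap-cycleMap f h same i
    with proj₂ (same (σ f (pos h i)) (σ f (pos h (next i)))) (i , inj₁ (refl , refl))
  ... | j , inj₁ (at-j , at-next-j) =
    inj₁ (trans (pos⁻¹-at h at-next-j) (cong next (sym (pos⁻¹-at h at-j))))
  ... | j , inj₂ (at-j , at-next-j) =
    inj₂ (trans (cong next (pos⁻¹-at h at-j)) (sym (pos⁻¹-at h at-next-j)))

  rigid⇒distinguishing : ∀ {r} (h : HamOrdering G) → (∀ h′ → SameCycle h h′) →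
    (L : Fin n → Fin r) → Rigid L → Distinguishing G r (L ∘ pos⁻¹ h)
  rigid⇒distinguishing h unique L L-rigid f f-label v =
    begin
      σ f v                               ≡⟨ cong (σ f) (sym (HamOrdering.right h v)) ⟩
      σ f (pos h (pos⁻¹ h v))             ≡⟨ sym (HamOrdering.right h _) ⟩
      pos h (positionMap f h (pos⁻¹ h v)) ≡⟨ cong (pos h) (fixes-positions (pos⁻¹ h v)) ⟩
      pos h (pos⁻¹ h v)                   ≡⟨ HamOrdering.right h v ⟩
      v                                   ∎
    where
    open ≡-Reasoning
    fixes-positions : ∀ i → positionMap f h i ≡ i
    fixes-positions = L-rigid (positionMap f h) (positionMap-injective f h)
      (positionMap-cycleMap f h (unique (transport f h)))
      (λ i → trans (f-label (pos h i)) (cong L (HamOrdering.left h i)))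

mainTheorem3 : (n : ℕ) → 6 ≤ n → (G : Graph n) → Connected G →
    UniquelyHamiltonian G → DistNum≤ G 2
mainTheorem3 (suc (suc (suc (suc (suc (suc m)))))) (s≤s (s≤s (s≤s (s≤s (s≤s (s≤s _)))))) G _
  (h , unique) =
  2 , ≤-refl , mark ∘ pos⁻¹ h , rigid⇒distinguishing h unique mark (mark-rigid m)
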